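{- Let $M$ be a $\lambda$-term such that $\mathtt{InferStrong}(M)$ returns $(\Pi,\psi)$, where the root of $\Pi$ is $\mathtt\Gamma\vdash_{\tt p}M:{\tt a}$. Then $\mathsf m\circ\psi(\Pi)$ is a derivation in system $\mathcal N_{\mathsf s}$ of $\mathsf m(\psi(\mathtt\Gamma))\vdash_{\mathsf s}M:\mathsf m(\psi({\tt a}))$.
   Context: $\lambda$-terms: $M,N::=x\mid\lambda x.M\mid MN$. Types $\mathbf T_{\mathsf s}$: $A::=a\mid\mu\to A$, $a$ a type variable, $\mu=[A_1,\dots,A_n]$ ($n\ge1$) a nonempty finite multiset. Type environments map term variables to multisets (all but finitely many empty); $\mathrm{dom}(\Gamma)=\{x\mid\Gamma(x)\neq[\,]\}$; $\uplus$ is pointwise multiset union; $\Gamma,x:\mu$ extends $\Gamma$ with $x\notin\mathrm{dom}(\Gamma)$. System $\mathcal N_{\mathsf s}$: (var) $x:[A]\vdash_{\mathsf s}x:A$; (many) from $\Gamma_i\vdash_{\mathsf s}M:A_i$ ($1\le i\le n$, $n\ge1$) infer $\biguplus_i\Gamma_i\vdash_{\mathsf s}M:[A_1,\dots,A_n]$; (app) from $\Gamma\vdash_{\mathsf s}M:\mu\to A$ and $\Delta\vdash_{\mathsf s}N:\mu$ infer $\Gamma\uplus\Delta\vdash_{\mathsf s}MN:A$; (abs-I) from $\Gamma,x:\mu\vdash_{\mathsf s}M:A$, $\mu\neq[\,]$, infer $\Gamma\vdash_{\mathsf s}\lambda x.M:\mu\to A$; (abs-K) from $\Gamma\vdash_{\mathsf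 s}M:B$, $x\notin\mathrm{dom}(\Gamma)$, $A\in\mathbf T_{\mathsf s}$, infer $\Gamma\vdash_{\mathsf s}\lambda x.M:[A]\to B$. Pre-types: ${\tt A}::={\tt a}\mid\sigma\to{\tt A}$, ${\tt a}$ a pre-type variable, $\sigma=\langle{\tt A}_1,\dots,{\tt A}_n\rangle$ ($n\ge0$) an ordered list; $|\sigma|$ length, $\cdot$ concatenation; pre-type environments map variables to lists, with pointwise concatenation. Disjoint = no common pre-type variable; fresh = occurring nowhere else. Strong pseudo-derivation $(\Pi,E_\Pi)$ for $M$: (var) $x:\langle{\tt a}\rangle\vdash_{\tt p}x:{\tt a}$, $E=\emptyset$; (many) from pairwise disjoint $\Sigma_i\triangleright\mathtt\Gamma_i\vdash_{\tt p}M:{\tt a}_i$ ($n\ge1$) infer $\mathtt\Gamma_1\cdot\ldots\cdot\mathtt\Gamma_n\vdash_{\tt p}M:\langle{\tt a}_1,\dots,{\tt a}_n\rangle$, $E=\bigcup E_{\Sigma_i}$; (app) from disjoint $\Sigma_1\triangleright\mathtt\Gamma\vdash_{\tt p}M:{\tt a}$, $\Sigma_2\triangleright\mathtt\Delta\vdash_{\tt p}N:\langle{\tt b}_1,\dots,{\tt b}_n\rangle$, ${\tt c}$ fresh, infer $\mathtt\Gamma\cdot\mathtt\Delta\vdash_{\tt p}MN:{\tt c}$, $E=E_{\Sigma_1}\cup E_{\Sigma_2}\cup\{{\tt a}\doteq\langle{\tt b}_1,\dots,{\tt b}_n\rangle\to{\tt c}\}$; (abs-I) from $\Sigma\triangleright\mathtt\Gamma,x:\sigma\vdash_{\tt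 p}M:{\tt a}$, $\sigma\neq\langle\rangle$, ${\tt b}$ fresh, infer $\mathtt\Gamma\vdash_{\tt p}\lambda x.M:{\tt b}$, $E=E_\Sigma\cup\{{\tt b}\doteq\sigma\to{\tt a}\}$; (abs-K) from $\Sigma\triangleright\mathtt\Gamma\vdash_{\tt p}M:{\tt a}$, $x\notin\mathrm{dom}(\mathtt\Gamma)$, ${\tt b},{\tt c}$ fresh, infer $\mathtt\Gamma\vdash_{\tt p}\lambda x.M:{\tt c}$, $E=E_\Sigma\cup\{{\tt c}\doteq\langle{\tt b}\rangle\to{\tt a}\}$. Modulo renaming; $\mathrm{PD}^{\mathsf s}_{\min}(M)$ has $n=1$ in all (many) rules. $\mathsf m$ maps pre-types to types: $\mathsf m({\tt a})=a$ (injective), $\mathsf m(\sigma\to{\tt A})=\mathsf m(\sigma)\to\mathsf m({\tt A})$, $\mathsf m(\langle{\tt A}_i\rangle_i)=[\mathsf m({\tt A}_i)]_i$, extended to environments and trees. Substitutions $\psi$ on pre-type variables extend homomorphically. Expansion $\mathsf{Exp}(\sigma,n,\Pi)$ ($\sigma\neq\langle\rangle$, $n\ge1$): if $\sigma=\langle{\tt a}_1,\dots,{\tt a}_m\rangle$ is the conclusion list of a (many) rule of $\Pi$ with subject $N$, replace the subtree there by a (many) rule whose $m+n$ premises are fresh pairwise disjoint copies $\vdash_{\tt p}N:{\tt a}_i$ of $\mathrm{PD}^{\mathsf s}_{\min}(N)$, and recompute the equation set; else unchanged. Unification rules $\to_{\mathsf u}$ on sets of equations: (erase) remove ${\tt A}\doteq{\tt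 A}$; (swap) $\sigma\to{\tt A}\doteq{\tt a}$ becomes ${\tt a}\doteq\sigma\to{\tt A}$; (arrow) $\sigma\to{\tt A}\doteq\tau\to{\tt B}$ becomes $\sigma\doteq\tau,{\tt A}\doteq{\tt B}$; (list) $\langle{\tt A}_1..{\tt A}_n\rangle\doteq\langle{\tt B}_1..{\tt B}_n\rangle$ becomes ${\tt A}_i\doteq{\tt B}_i$; (subs) given ${\tt a}\doteq{\tt A}$ with ${\tt a}\notin\mathsf{Var}({\tt A})$ and ${\tt a}$ occurring in the rest $S$, replace all occurrences of ${\tt a}$ in $S$ by ${\tt A}$. $\to_{\mathsf o}$: same, with (subs) restricted to the case ${\tt a}$ occurs in $S$ outside a list and replacing only occurrences not inside lists. $\mathrm{nf}_{\mathsf u},\mathrm{nf}_{\mathsf o}$ denote the unique normal forms. Blocked form: contains $\sigma\doteq\tau$ with $|\sigma|\neq|\tau|$. Solved form: no list equations, all equations ${\tt a}_i\doteq{\tt B}_i$ with distinct ${\tt a}_i$ not occurring in any ${\tt B}_k$; its most general unifier $\mathrm{mgu}$ maps ${\tt a}_i\mapsto{\tt B}_i$. Algorithm $\mathtt{InferStrong}(M)$ (non-deterministic): $(\Pi,E):=\mathrm{PD}^{\mathsf s}_{\min}(M)$; $E:=\mathrm{nf}_{\mathsf o}(E)$; while $E$ is in blocked form: choose $\sigma\doteq\tau\in E$ with $|\sigma|\neq|\tau|$; if $|\sigma|>|\tau|$ set $(\Pi,E):=\mathsf{Exp}(\tau,|\sigma|-|\tau|,\Pi)$, else $(\Pi,E):=\mathsf{Exp}(\sigma,|\tau|-|\sigma|,\Pi)$;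 then $E:=\mathrm{nf}_{\mathsf o}(E)$. After the loop: $E:=\mathrm{nf}_{\mathsf u}(E)$, $\psi:=\mathrm{mgu}(E)$, return $(\Pi,\psi)$. -}

module Defs where

open import Data.Nat using (ℕ; _∸_; _<_; _≡ᵇ_)
open import Data.Bool using (if_then_else_)
open import Data.List using (List; []; _∷_; map; concat; length; _++_; take; zipWith)
open import Data.List.Relation.Unary.All using (All)
open import Data.List.Relation.Unary.Any using (Any)
open import Data.List.Membership.Propositional using (_∈_)
open import Data.List.Relation.Binary.Permutation.Homogeneous using (Permutation)
open import Data.Product using (Σ; _×_; _,_)
open import Data.Sum using (_⊎_)
open import Data.Unit using (⊤)
open import Data.Empty using (⊥)
open import Relation.Nullary using (¬_)
open import Relation.Binary.PropositionalEquality using (_≡_; _≢_)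
open import Relation.Binary.Construct.Closure.ReflexiveTransitive using (Star)

infixl 7 _·_
data Term : Set where
  v_    : ℕ → Term
  ƛ_⇒_  : ℕ → Term → Term
  _·_   : Term → Term → Term

-- Types T_s.  A multiset [A1..An] is represented by a list; lists are
-- compared up to (deep) permutation, see _≈T_ / _≈M_ below.
-- Well-formedness (all multisets non-empty) is the predicate WF.

infixr 6 _⇒_
data Ty : Set where
  tv  : ℕ → Ty
  _⇒_ : List Ty → Ty → Ty

infix 4 _≈T_
data _≈T_ : Ty → Ty → Set where
  tv≈ : ∀ a → tv a ≈T tv a
  ⇒≈  : ∀ {μ ν A B} → Permutation _≈T_ μ ν → A ≈T B → (μ ⇒ A) ≈T (ν ⇒ B)

infix 4 _≈M_
_≈M_ : List Ty → List Ty → Set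
_≈M_ = Permutation _≈T_

data WF : Ty → Set where
  tvWF : ∀ a → WF (tv a)
  ⇒WF  : ∀ {μ A} → μ ≢ [] → All WF μ → WF A → WF (μ ⇒ A)

-- Pre-types (ordered lists, possibly empty)

infixr 6 _⇒ₚ_
data PType : Set where
  pv   : ℕ → PType
  _⇒ₚ_ : List PType → PType → PType

mutual
  mP : PType → Ty
  mP (pv a)     = tv a
  mP (σ ⇒ₚ A)   = mL σ ⇒ mP A

  mL : List PType → List Ty
  mL []       = []
  mL (A ∷ σ)  = mP A ∷ mL σ

mutual
  sub : (ℕ → PType) → PType → PType
  sub ψ (pv a)    = ψ a
  sub ψ (σ ⇒ₚ A)  = subL ψ σ ⇒ₚ sub ψ A

  subL : (ℕ → PType) → List PType → List PType
  subL ψ []       = []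
  subL ψ (A ∷ σ)  = sub ψ A ∷ subL ψ σ

data _∈PT_ (a : ℕ) : PType → Set where
  here : a ∈PT pv a
  dom  : ∀ {σ A} → Any (a ∈PT_) σ → a ∈PT (σ ⇒ₚ A)
  cod  : ∀ {σ A} → a ∈PT A → a ∈PT (σ ⇒ₚ A)

_∈PL_ : ℕ → List PType → Set
a ∈PL σ = Any (a ∈PT_) σ

IsVar : PType → Set
IsVar A = Σ ℕ λ a → A ≡ pv a

Env : Set → Set
Env T = ℕ → List T

mapEnv : {S T : Set} → (S → T) → Env S → Env T
mapEnv f Γ y = map f (Γ y)

-- Derivation trees: every node is labelled by its rule and its
-- conclusion judgment  Γ ⊢ M : A  (or  Γ ⊢ M : μ  for (many)).
--   rVar  Γ M A                : (var)
--   rApp  Γ M A t u            : (app), premises t (function) and u (argument, a (many) node)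
--   rAbsI Γ x M A t            : (abs-I) binding x
--   rAbsK Γ x M A B t          : (abs-K) binding x, B = the type put in [B] → ...
--   rMany Γ M μ ts             : (many) with premises ts
mutual
  data Tree (T : Set) : Set where
    rVar  : Env T → Term → T → Tree T
    rApp  : Env T → Term → T → Tree T → MTree T → Tree T
    rAbsI : Env T → ℕ → Term → T → Tree T → Tree T
    rAbsK : Env T → ℕ → Term → T → T → Tree T → Tree T

  data MTree (T : Set) : Set where
    rMany : Env T → Term → List T → List (Tree T) → MTree T

module _ {T : Set} where
  envT : Tree T → Env T
  envT (rVar Γ _ _)         = Γ
  envT (rApp Γ _ _ _ _)     = Γ
  envT (rAbsI Γ _ _ _ _)    = Γ
  envT (rAbsK Γ _ _ _ _ _)  = Γ

  subjT : Tree T → Term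
  subjT (rVar _ M _)         = M
  subjT (rApp _ M _ _ _)     = M
  subjT (rAbsI _ _ M _ _)    = M
  subjT (rAbsK _ _ M _ _ _)  = M

  tyT : Tree T → T
  tyT (rVar _ _ A)         = A
  tyT (rApp _ _ A _ _)     = A
  tyT (rAbsI _ _ _ A _)    = A
  tyT (rAbsK _ _ _ A _ _)  = A

  envM : MTree T → Env T
  envM (rMany Γ _ _ _) = Γ

  subjM : MTree T → Term
  subjM (rMany _ M _ _) = M

  tyM : MTree T → List T
  tyM (rMany _ _ μ _) = μ

mutual
  mapTree : {S T : Set} → (S → T) → Tree S → Tree T
  mapTree f (rVar Γ M A)         = rVar (mapEnv f Γ) M (f A)
  mapTree f (rApp Γ M A t u)     = rApp (mapEnv f Γ) M (f A) (mapTree f t) (mapMTree f u)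
  mapTree f (rAbsI Γ x M A t)    = rAbsI (mapEnv f Γ) x M (f A) (mapTree f t)
  mapTree f (rAbsK Γ x M A B t)  = rAbsK (mapEnv f Γ) x M (f A) (f B) (mapTree f t)

  mapMTree : {S T : Set} → (S → T) → MTree S → MTree T
  mapMTree f (rMany Γ M μ ts) = rMany (mapEnv f Γ) M (map f μ) (mapTrees f ts)

  mapTrees : {S T : Set} → (S → T) → List (Tree S) → List (Tree T)
  mapTrees f []        = []
  mapTrees f (t ∷ ts)  = mapTree f t ∷ mapTrees f ts

mutual
  DerivS : Tree Ty → Set
  DerivS (rVar Γ M A) =
    Σ ℕ λ x → M ≡ v x × WF A × Γ x ≈M (A ∷ []) × (∀ y → y ≢ x → Γ y ≡ [])
  DerivS (rApp Γ M A t u) =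
    DerivS t × DerivSM u × M ≡ subjT t · subjM u
    × tyT t ≈T (tyM u ⇒ A)
    × (∀ y → Γ y ≈M (envT t y ++ envM u y))
  DerivS (rAbsI Γ x M A t) =
    DerivS t × M ≡ ƛ x ⇒ subjT t
    × envT t x ≢ [] × Γ x ≡ []
    × (∀ y → y ≢ x → Γ y ≈M envT t y)
    × A ≈T (envT t x ⇒ tyT t)
  DerivS (rAbsK Γ x M A B t) =
    DerivS t × M ≡ ƛ x ⇒ subjT t
    × envT t x ≡ []
    × (∀ y → Γ y ≈M envT t y)
    × WF B × A ≈T ((B ∷ []) ⇒ tyT t)

  DerivSM : MTree Ty → Set
  DerivSM (rMany Γ M μ ts) =
    ts ≢ [] × DerivSL ts × All (λ t → subjT t ≡ M) ts
    × μ ≈M map tyT ts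
    × (∀ y → Γ y ≈M concat (map (λ t → envT t y) ts))

  DerivSL : List (Tree Ty) → Set
  DerivSL []        = ⊤
  DerivSL (t ∷ ts)  = DerivS t × DerivSL ts

OccEnv : ℕ → Env PType → Set
OccEnv a Γ = Σ ℕ λ y → a ∈PL Γ y

mutual
  OccT : ℕ → Tree PType → Set
  OccT a (rVar Γ _ A)         = OccEnv a Γ ⊎ a ∈PT A
  OccT a (rApp Γ _ A t u)     = OccEnv a Γ ⊎ a ∈PT A ⊎ OccT a t ⊎ OccM a u
  OccT a (rAbsI Γ _ _ A t)    = OccEnv a Γ ⊎ a ∈PT A ⊎ OccT a t
  OccT a (rAbsK Γ _ _ A B t)  = OccEnv a Γ ⊎ a ∈PT A ⊎ a ∈PT B ⊎ OccT a t

  OccM : ℕ → MTree PType → Set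
  OccM a (rMany Γ _ σ ts) = OccEnv a Γ ⊎ a ∈PL σ ⊎ OccL a ts

  OccL : ℕ → List (Tree PType) → Set
  OccL a []        = ⊥
  OccL a (t ∷ ts)  = OccT a t ⊎ OccL a ts

Disjoint : (ℕ → Set) → (ℕ → Set) → Set
Disjoint P Q = ∀ a → P a → Q a → ⊥

PairwiseDisjoint : List (Tree PType) → Set
PairwiseDisjoint []        = ⊤
PairwiseDisjoint (t ∷ ts)  =
  Disjoint (λ a → OccT a t) (λ a → OccL a ts) × PairwiseDisjoint ts

mutual
  Strong : Tree PType → Set
  Strong (rVar Γ M A) =
    Σ ℕ λ x → Σ ℕ λ a →
      M ≡ v x × A ≡ pv a × Γ x ≡ (pv a ∷ []) × (∀ y → y ≢ x → Γ y ≡ [])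
  Strong (rApp Γ M C t u) =
    Σ ℕ λ c →
      Strong t × StrongM u × M ≡ subjT t · subjM u
      × IsVar (tyT t) × C ≡ pv c
      × Disjoint (λ a → OccT a t) (λ a → OccM a u)
      × ¬ OccT c t × ¬ OccM c u
      × (∀ y → Γ y ≡ envT t y ++ envM u y)
  Strong (rAbsI Γ x M B t) =
    Σ ℕ λ b →
      Strong t × M ≡ ƛ x ⇒ subjT t
      × envT t x ≢ [] × Γ x ≡ []
      × (∀ y → y ≢ x → Γ y ≡ envT t y)
      × IsVar (tyT t) × B ≡ pv b × ¬ OccT b t
  Strong (rAbsK Γ x M C B t) =
    Σ ℕ λ b → Σ ℕ λ c →
      Strong t × M ≡ ƛ x ⇒ subjT t
      × envT t x ≡ []
      × (∀ y → Γ y ≡ envT t y)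
      × IsVar (tyT t) × C ≡ pv c × B ≡ pv b
      × b ≢ c × ¬ OccT b t × ¬ OccT c t

  StrongM : MTree PType → Set
  StrongM (rMany Γ M σ ts) =
    ts ≢ [] × StrongL ts × All (λ t → subjT t ≡ M) ts
    × All (λ t → IsVar (tyT t)) ts
    × σ ≡ map tyT ts
    × PairwiseDisjoint ts
    × (∀ y → Γ y ≡ concat (map (λ t → envT t y) ts))

  StrongL : List (Tree PType) → Set
  StrongL []        = ⊤
  StrongL (t ∷ ts)  = Strong t × StrongL ts

mutual
  Minimal : Tree PType → Set
  Minimal (rVar _ _ _)         = ⊤
  Minimal (rApp _ _ _ t u)     = Minimal t × MinimalM u
  Minimal (rAbsI _ _ _ _ t)    = Minimal t
  Minimal (rAbsK _ _ _ _ _ t)  = Minimal t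

  MinimalM : MTree PType → Set
  MinimalM (rMany _ _ _ [])            = ⊥
  MinimalM (rMany _ _ _ (t ∷ []))      = Minimal t
  MinimalM (rMany _ _ _ (_ ∷ _ ∷ _))   = ⊥

-- Π is (a renaming of) PD^s_min(M)
IsPDmin : Term → Tree PType → Set
IsPDmin M Π = Strong Π × Minimal Π × subjT Π ≡ M

-- Equations and the equation set E_Π (a set, represented by a list)

infix 4 _≐_ _≐ₗ_
data Eqn : Set where
  _≐_  : PType → PType → Eqn
  _≐ₗ_ : List PType → List PType → Eqn

mutual
  eqs : Tree PType → List Eqn
  eqs (rVar _ _ _)          = []
  eqs (rApp _ _ C t u)      = eqs t ++ eqsM u ++ (tyT t ≐ (tyM u ⇒ₚ C)) ∷ []
  eqs (rAbsI _ x _ B t)     = eqs t ++ (B ≐ (envT t x ⇒ₚ tyT t)) ∷ []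
  eqs (rAbsK _ _ _ C B t)   = eqs t ++ (C ≐ ((B ∷ []) ⇒ₚ tyT t)) ∷ []

  eqsM : MTree PType → List Eqn
  eqsM (rMany _ _ _ ts) = eqsL ts

  eqsL : List (Tree PType) → List Eqn
  eqsL []        = []
  eqsL (t ∷ ts)  = eqs t ++ eqsL ts

infix 4 _≈ₛ_
_≈ₛ_ : List Eqn → List Eqn → Set
E ≈ₛ F = ∀ e → (e ∈ E → e ∈ F) × (e ∈ F → e ∈ E)

_∈Eq_ : ℕ → Eqn → Set
a ∈Eq (A ≐ B)  = a ∈PT A ⊎ a ∈PT B
a ∈Eq (σ ≐ₗ τ) = a ∈PL σ ⊎ a ∈PL τ

OccO : ℕ → PType → Set
OccO a (pv b)   = a ≡ b
OccO a (σ ⇒ₚ A) = OccO a A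

_∈OEq_ : ℕ → Eqn → Set
a ∈OEq (A ≐ B)  = OccO a A ⊎ OccO a B
a ∈OEq (σ ≐ₗ τ) = ⊥

[_:=_] : ℕ → PType → ℕ → PType
[ a := A ] b = if a ≡ᵇ b then A else pv b

substEq : ℕ → PType → Eqn → Eqn
substEq a A (B ≐ C)  = sub [ a := A ] B ≐ sub [ a := A ] C
substEq a A (σ ≐ₗ τ) = subL [ a := A ] σ ≐ₗ subL [ a := A ] τ

substO : ℕ → PType → PType → PType
substO a A (pv b)   = [ a := A ] b
substO a A (σ ⇒ₚ B) = σ ⇒ₚ substO a A B

substOEq : ℕ → PType → Eqn → Eqn
substOEq a A (B ≐ C)  = substO a A B ≐ substO a A C
substOEq a A (σ ≐ₗ τ) = σ ≐ₗ τ

-- one rule applied to the set {e} ⊎ S, giving the set R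
data CoreCommon (e : Eqn) (S : List Eqn) : List Eqn → Set where
  erase : ∀ {A} → e ≡ (A ≐ A) → CoreCommon e S S
  swap  : ∀ {σ A a} → e ≡ ((σ ⇒ₚ A) ≐ pv a) →
          CoreCommon e S ((pv a ≐ (σ ⇒ₚ A)) ∷ S)
  arrow : ∀ {σ A τ B} → e ≡ ((σ ⇒ₚ A) ≐ (τ ⇒ₚ B)) →
          CoreCommon e S ((σ ≐ₗ τ) ∷ (A ≐ B) ∷ S)
  list  : ∀ {σ τ} → e ≡ (σ ≐ₗ τ) → length σ ≡ length τ →
          CoreCommon e S (zipWith _≐_ σ τ ++ S)

data CoreU (e : Eqn) (S : List Eqn) : List Eqn → Set where
  common : ∀ {R} → CoreCommon e S R → CoreU e S R
  subs   : ∀ {a A} → e ≡ (pv a ≐ A) → ¬ a ∈PT A → Any (a ∈Eq_) S →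
           CoreU e S (e ∷ map (substEq a A) S)

data CoreO (e : Eqn) (S : List Eqn) : List Eqn → Set where
  common : ∀ {R} → CoreCommon e S R → CoreO e S R
  subs   : ∀ {a A} → e ≡ (pv a ≐ A) → ¬ a ∈PT A → Any (a ∈OEq_) S →
           CoreO e S (e ∷ map (substOEq a A) S)

_→u_ : List Eqn → List Eqn → Set
E →u F = Σ Eqn λ e → Σ (List Eqn) λ S → Σ (List Eqn) λ R →
           E ≈ₛ (e ∷ S) × ¬ e ∈ S × CoreU e S R × F ≈ₛ R

_→o_ : List Eqn → List Eqn → Set
E →o F = Σ Eqn λ e → Σ (List Eqn) λ S → Σ (List Eqn) λ R →
           E ≈ₛ (e ∷ S) × ¬ e ∈ S × CoreO e S R × F ≈ₛ R

IsNF : (List Eqn → List Eqn → Set) → List Eqn → List Eqn → Set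
IsNF _⟶_ E F = Star _⟶_ E F × (∀ G → ¬ (F ⟶ G))

Blocked : List Eqn → Set
Blocked E = Σ (List PType) λ σ → Σ (List PType) λ τ →
              (σ ≐ₗ τ) ∈ E × length σ ≢ length τ

Solved : List Eqn → Set
Solved E =
  (∀ e → e ∈ E → Σ ℕ λ a → Σ PType λ B → e ≡ (pv a ≐ B))
  × (∀ a B B′ → (pv a ≐ B) ∈ E → (pv a ≐ B′) ∈ E → B ≡ B′)
  × (∀ a B b B′ → (pv a ≐ B) ∈ E → (pv b ≐ B′) ∈ E → ¬ a ∈PT B′)

IsMgu : List Eqn → (ℕ → PType) → Set
IsMgu E ψ =
  (∀ a B → (pv a ≐ B) ∈ E → ψ a ≡ B)
  × (∀ a → (∀ B → ¬ (pv a ≐ B) ∈ E) → ψ a ≡ pv a)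

mutual
  HasManyT : List PType → Tree PType → Set
  HasManyT σ (rVar _ _ _)         = ⊥
  HasManyT σ (rApp _ _ _ t u)     = HasManyT σ t ⊎ HasManyM σ u
  HasManyT σ (rAbsI _ _ _ _ t)    = HasManyT σ t
  HasManyT σ (rAbsK _ _ _ _ _ t)  = HasManyT σ t

  HasManyM : List PType → MTree PType → Set
  HasManyM σ (rMany _ _ ρ ts) = ρ ≡ σ ⊎ HasManyL σ ts

  HasManyL : List PType → List (Tree PType) → Set
  HasManyL σ []        = ⊥
  HasManyL σ (t ∷ ts)  = HasManyT σ t ⊎ HasManyL σ ts

-- Repl σ New Π Π′ : Π′ is Π where the (many) node with conclusion list σ
-- and subject N is replaced by some u′ with New N u′; the environments on
-- the path to the root are left free (they are recomputed: Π′ is then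
-- required to be a strong pseudo-derivation).
mutual
  data ReplT (σ : List PType) (New : Term → MTree PType → Set)
       : Tree PType → Tree PType → Set where
    appL : ∀ {Γ Γ′ M C t t′ u} → ReplT σ New t t′ →
           ReplT σ New (rApp Γ M C t u) (rApp Γ′ M C t′ u)
    appR : ∀ {Γ Γ′ M C t u u′} → ReplM σ New u u′ →
           ReplT σ New (rApp Γ M C t u) (rApp Γ′ M C t u′)
    absI : ∀ {Γ Γ′ x M B t t′} → ReplT σ New t t′ →
           ReplT σ New (rAbsI Γ x M B t) (rAbsI Γ′ x M B t′)
    absK : ∀ {Γ Γ′ x M C B t t′} → ReplT σ New t t′ →
           ReplT σ New (rAbsK Γ x M C B t) (rAbsK Γ′ x M C B t′)

  data ReplM (σ : List PType) (New : Term → MTree PType → Set)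
       : MTree PType → MTree PType → Set where
    here   : ∀ {Γ N ts u′} → New N u′ → ReplM σ New (rMany Γ N σ ts) u′
    inside : ∀ {Γ Γ′ N ρ ts ts′} → ReplL σ New ts ts′ →
             ReplM σ New (rMany Γ N ρ ts) (rMany Γ′ N ρ ts′)

  data ReplL (σ : List PType) (New : Term → MTree PType → Set)
       : List (Tree PType) → List (Tree PType) → Set where
    hd : ∀ {t t′ ts} → ReplT σ New t t′ → ReplL σ New (t ∷ ts) (t′ ∷ ts)
    tl : ∀ {t ts ts′} → ReplL σ New ts ts′ → ReplL σ New (t ∷ ts) (t ∷ ts′)

NewMany : List PType → ℕ → Term → MTree PType → Set
NewMany σ n N u′ =
  Σ (Env PType) λ Γ → Σ (List PType) λ σ′ → Σ (List (Tree PType)) λ ts →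
    u′ ≡ rMany Γ N σ′ ts × length ts ≡ length σ Data.Nat.+ n
    × All (IsPDmin N) ts × take (length σ) σ′ ≡ σ

data Exp (σ : List PType) (n : ℕ) (Π : Tree PType) : Tree PType → Set where
  expand : ∀ {Π′} → ReplT σ (NewMany σ n) Π Π′ → Strong Π′ → Exp σ n Π Π′
  keep   : ¬ HasManyT σ Π → Exp σ n Π Π

-- The algorithm InferStrong (non-deterministic), as a relation

ExpChoice : List PType → List PType → Tree PType → Tree PType → Set
ExpChoice σ τ Π Π′ =
  (length τ < length σ × Exp τ (length σ ∸ length τ) Π Π′)
  ⊎ (length σ < length τ × Exp σ (length τ ∸ length σ) Π Π′)

data Loop : Tree PType → List Eqn → Tree PType → List Eqn → Set where
  stop : ∀ {Π E} → ¬ Blocked E → Loop Π E Π E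
  step : ∀ {Π E Π₁ E₁ Πf Ef σ τ} →
         (σ ≐ₗ τ) ∈ E → length σ ≢ length τ →
         ExpChoice σ τ Π Π₁ → IsNF _→o_ (eqs Π₁) E₁ →
         Loop Π₁ E₁ Πf Ef → Loop Π E Πf Ef

data InferStrong (M : Term) : Tree PType → (ℕ → PType) → Set where
  run : ∀ {Π₀ E₀ Π E Eu ψ} →
        IsPDmin M Π₀ → IsNF _→o_ (eqs Π₀) E₀ →
        Loop Π₀ E₀ Π E → IsNF _→u_ E Eu → Solved Eu → IsMgu Eu ψ →
        InferStrong M Π ψ

mψ : (ℕ → PType) → PType → Ty
mψ ψ A = mP (sub ψ A)

{-# OPTIONS --safe #-}
module Submission where

-- Each rewriting step of →o and →u is sound: a substitution solving the
-- result solves the equations it came from.  The mgu of the solved form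
-- returned at the end solves it, hence solves E_Π.  Each equation of E_Π
-- is exactly the side condition of an (app) or (abs) rule of Π, so m ∘ ψ
-- turns these conditions into equalities of types.  The remaining point is
-- that the resulting types lie in T_s: in a strong pseudo-derivation every
-- list occurring in E_Π is non-empty, the rewriting steps preserve this,
-- and so every value of ψ has only non-empty lists.  Expansion keeps Π a
-- strong pseudo-derivation, so all of this applies to the final Π.

open import Defs
open import Data.Nat using (ℕ; _≟_; _≡ᵇ_)
open import Data.Nat.Properties using (≡ᵇ⇒≡; suc-injective)
open import Data.Bool using (true; false; T)
open import Data.Unit using (tt)
open import Data.Empty using (⊥-elim)
open import Data.Product using (Σ; _×_; _,_; proj₁; proj₂)
open import Data.Sum using (_⊎_; inj₁; inj₂)
open import Data.List using (List; []; _∷_; map; concat; _++_; zipWith; length)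
open import Data.List.Properties using (map-++)
open import Data.List.Relation.Unary.All as All using (All; []; _∷_)
open import Data.List.Relation.Unary.All.Properties using (++⁺; ++⁻; ++⁻ˡ; ++⁻ʳ; map⁺; map⁻; anti-mono)
open import Data.List.Relation.Unary.Any using (here; there; any?)
open import Data.List.Membership.Propositional using (_∈_; find; lose)
open import Data.List.Relation.Binary.Subset.Propositional using (_⊆_)
open import Data.List.Relation.Binary.Pointwise using (Pointwise; []; _∷_)
open import Data.List.Relation.Binary.Permutation.Homogeneous using (Permutation)
open import Function using (id; _∘_)
open import Relation.Nullary using (¬_; Dec; yes; no)
open import Relation.Binary.PropositionalEquality using (_≡_; _≢_; refl; sym; trans; cong; cong₂; subst; module ≡-Reasoning)
open import Relation.Binary.Construct.Closure.ReflexiveTransitive as Star using (Star)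

mutual
  ≈T-refl : ∀ A → A ≈T A
  ≈T-refl (tv a)  = tv≈ a
  ≈T-refl (μ ⇒ A) = ⇒≈ (Permutation.refl (≈T-refl-pointwise μ)) (≈T-refl A)

  ≈T-refl-pointwise : ∀ μ → Pointwise _≈T_ μ μ
  ≈T-refl-pointwise []      = []
  ≈T-refl-pointwise (A ∷ μ) = ≈T-refl A ∷ ≈T-refl-pointwise μ

≡⇒≈T : ∀ {A B} → A ≡ B → A ≈T B
≡⇒≈T {A} refl = ≈T-refl A

≡⇒≈M : ∀ {μ ν} → μ ≡ ν → μ ≈M ν
≡⇒≈M {μ} refl = Permutation.refl (≈T-refl-pointwise μ)

≢[]-preserved : {A B : Set} (f : List A → List B) →
                (∀ {x xs} → f (x ∷ xs) ≢ []) → ∀ {xs} → xs ≢ [] → f xs ≢ []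
≢[]-preserved f f∷≢[] {[]}    []≢[] = ⊥-elim ([]≢[] refl)
≢[]-preserved f f∷≢[] {_ ∷ _} _     = f∷≢[]

data WFₚ : PType → Set where
  pvWF  : ∀ a → WFₚ (pv a)
  ⇒ₚWF : ∀ {σ A} → σ ≢ [] → All WFₚ σ → WFₚ A → WFₚ (σ ⇒ₚ A)

mutual
  mP-WF : ∀ {A} → WFₚ A → WF (mP A)
  mP-WF (pvWF a)         = tvWF a
  mP-WF (⇒ₚWF σ≢[] σ A) = ⇒WF (≢[]-preserved mL (λ ()) σ≢[]) (mL-WF σ) (mP-WF A)

  mL-WF : ∀ {σ} → All WFₚ σ → All WF (mL σ)
  mL-WF []       = []
  mL-WF (A ∷ σ) = mP-WF A ∷ mL-WF σ

IsVar-WF : ∀ {A} → IsVar A → WFₚ A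
IsVar-WF (a , refl) = pvWF a

mutual
  sub-WF : ∀ {φ} → (∀ b → WFₚ (φ b)) → ∀ {A} → WFₚ A → WFₚ (sub φ A)
  sub-WF φ-WF (pvWF a)         = φ-WF a
  sub-WF φ-WF (⇒ₚWF σ≢[] σ A) =
    ⇒ₚWF (≢[]-preserved (subL _) (λ ()) σ≢[]) (subL-WF φ-WF σ) (sub-WF φ-WF A)

  subL-WF : ∀ {φ} → (∀ b → WFₚ (φ b)) → ∀ {σ} → All WFₚ σ → All WFₚ (subL φ σ)
  subL-WF φ-WF []       = []
  subL-WF φ-WF (A ∷ σ) = sub-WF φ-WF A ∷ subL-WF φ-WF σ

[:=]-WF : ∀ a {A} → WFₚ A → ∀ b → WFₚ ([ a := A ] b)
[:=]-WF a A b with a ≡ᵇ b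
... | true  = A
... | false = pvWF b

substO-WF : ∀ a {A} → WFₚ A → ∀ {B} → WFₚ B → WFₚ (substO a A B)
substO-WF a A (pvWF b)         = [:=]-WF a A b
substO-WF a A (⇒ₚWF σ≢[] σ B) = ⇒ₚWF σ≢[] σ (substO-WF a A B)

mutual
  sub-local : ∀ {φ φ′} A → (∀ b → b ∈PT A → φ b ≡ φ′ b) → sub φ A ≡ sub φ′ A
  sub-local (pv b)   φ≗φ′ = φ≗φ′ b here
  sub-local (σ ⇒ₚ A) φ≗φ′ =
    cong₂ _⇒ₚ_ (subL-local σ (λ b → φ≗φ′ b ∘ dom)) (sub-local A (λ b → φ≗φ′ b ∘ cod))

  subL-local : ∀ {φ φ′} σ → (∀ b → b ∈PL σ → φ b ≡ φ′ b) → subL φ σ ≡ subL φ′ σ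
  subL-local []      φ≗φ′ = refl
  subL-local (A ∷ σ) φ≗φ′ =
    cong₂ _∷_ (sub-local A (λ b → φ≗φ′ b ∘ here)) (subL-local σ (λ b → φ≗φ′ b ∘ there))

mutual
  sub-pv : ∀ A → sub pv A ≡ A
  sub-pv (pv b)   = refl
  sub-pv (σ ⇒ₚ A) = cong₂ _⇒ₚ_ (subL-pv σ) (sub-pv A)

  subL-pv : ∀ σ → subL pv σ ≡ σ
  subL-pv []      = refl
  subL-pv (A ∷ σ) = cong₂ _∷_ (sub-pv A) (subL-pv σ)

mutual
  sub-∘ : ∀ φ ψ A → sub ψ (sub φ A) ≡ sub (sub ψ ∘ φ) A
  sub-∘ φ ψ (pv b)   = refl
  sub-∘ φ ψ (σ ⇒ₚ A) = cong₂ _⇒ₚ_ (subL-∘ φ ψ σ) (sub-∘ φ ψ A)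

  subL-∘ : ∀ φ ψ σ → subL ψ (subL φ σ) ≡ subL (sub ψ ∘ φ) σ
  subL-∘ φ ψ []      = refl
  subL-∘ φ ψ (A ∷ σ) = cong₂ _∷_ (sub-∘ φ ψ A) (subL-∘ φ ψ σ)

sub-fixes : ∀ {ψ} A → (∀ b → b ∈PT A → ψ b ≡ pv b) → sub ψ A ≡ A
sub-fixes A ψ≗pv = trans (sub-local A ψ≗pv) (sub-pv A)

module _ {ψ : ℕ → PType} {a : ℕ} {A : PType} (ψa≡ψA : ψ a ≡ sub ψ A) where

  sub-[:=] : ∀ b → sub ψ ([ a := A ] b) ≡ ψ b
  sub-[:=] b with a ≡ᵇ b in a≡ᵇb
  ... | true  = trans (sym ψa≡ψA) (cong ψ (≡ᵇ⇒≡ a b (subst T (sym a≡ᵇb) tt)))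
  ... | false = refl

  sub-sub-[:=] : ∀ B → sub ψ (sub [ a := A ] B) ≡ sub ψ B
  sub-sub-[:=] B = trans (sub-∘ [ a := A ] ψ B) (sub-local B (λ b _ → sub-[:=] b))

  subL-subL-[:=] : ∀ σ → subL ψ (subL [ a := A ] σ) ≡ subL ψ σ
  subL-subL-[:=] σ = trans (subL-∘ [ a := A ] ψ σ) (subL-local σ (λ b _ → sub-[:=] b))

  sub-substO : ∀ B → sub ψ (substO a A B) ≡ sub ψ B
  sub-substO (pv b)   = sub-[:=] b
  sub-substO (σ ⇒ₚ B) = cong (subL ψ σ ⇒ₚ_) (sub-substO B)

Solves : (ℕ → PType) → Eqn → Set
Solves ψ (A ≐ B)  = sub ψ A ≡ sub ψ B
Solves ψ (σ ≐ₗ τ) = subL ψ σ ≡ subL ψ τ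

Unifies : (ℕ → PType) → List Eqn → Set
Unifies ψ = All (Solves ψ)

WFEq : Eqn → Set
WFEq (A ≐ B)  = WFₚ A × WFₚ B
WFEq (σ ≐ₗ τ) = All WFₚ σ × All WFₚ τ

-- _→u_ and _→o_ unfold to Step CoreU and Step CoreO.
Step : (Eqn → List Eqn → List Eqn → Set) → List Eqn → List Eqn → Set
Step Core E F = Σ Eqn λ e → Σ (List Eqn) λ S → Σ (List Eqn) λ R →
                  E ≈ₛ (e ∷ S) × ¬ e ∈ S × Core e S R × F ≈ₛ R

≈ₛ⇒⊆ : ∀ {E F} → E ≈ₛ F → E ⊆ F
≈ₛ⇒⊆ E≈F {e} = proj₁ (E≈F e)

≈ₛ⇒⊇ : ∀ {E F} → E ≈ₛ F → F ⊆ E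
≈ₛ⇒⊇ E≈F {e} = proj₂ (E≈F e)

module _ {Core : Eqn → List Eqn → List Eqn → Set} {P : Eqn → Set} where

  star-reflects : (∀ {e S R} → Core e S R → All P R → P e × All P S) →
                  ∀ {E F} → Star (Step Core) E F → All P F → All P E
  star-reflects core-reflects =
    Star.fold (λ E F → All P F → All P E) (λ step k → reflects step ∘ k) id
    where
    reflects : ∀ {E F} → Step Core E F → All P F → All P E
    reflects (e , S , R , E≈eS , _ , core , F≈R) PF =
      let Pe , PS = core-reflects core (anti-mono (≈ₛ⇒⊇ F≈R) PF)
      in anti-mono (≈ₛ⇒⊆ E≈eS) (Pe ∷ PS)

  star-preserves : (∀ {e S R} → Core e S R → P e → All P S → All P R) →
                   ∀ {E F} → Star (Step Core) E F → All P E → All P F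
  star-preserves core-preserves =
    Star.fold (λ E F → All P E → All P F) (λ step k → k ∘ preserves step) id
    where
    preserves : ∀ {E F} → Step Core E F → All P E → All P F
    preserves (e , S , R , E≈eS , _ , core , F≈R) PE with anti-mono (≈ₛ⇒⊇ E≈eS) PE
    ... | Pe ∷ PS = anti-mono (≈ₛ⇒⊆ F≈R) (core-preserves core Pe PS)

zip-solves : ∀ {ψ} σ τ → length σ ≡ length τ → Unifies ψ (zipWith _≐_ σ τ) →
             subL ψ σ ≡ subL ψ τ
zip-solves []      []      _   _           = refl
zip-solves (A ∷ σ) (B ∷ τ) len (A≡B ∷ σ≡τ) = cong₂ _∷_ A≡B (zip-solves σ τ (suc-injective len) σ≡τ)

zip-WF : ∀ {σ τ} → All WFₚ σ → All WFₚ τ → All WFEq (zipWith _≐_ σ τ)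
zip-WF []      _       = []
zip-WF (_ ∷ _) []      = []
zip-WF (A ∷ σ) (B ∷ τ) = (A , B) ∷ zip-WF σ τ

module _ {ψ : ℕ → PType} where

  common-reflects : ∀ {e S R} → CoreCommon e S R → Unifies ψ R → Solves ψ e × Unifies ψ S
  common-reflects (erase refl)            ψS                = refl , ψS
  common-reflects (swap refl)             (a≡σA ∷ ψS)       = sym a≡σA , ψS
  common-reflects (arrow refl)            (σ≡τ ∷ A≡B ∷ ψS) = cong₂ _⇒ₚ_ σ≡τ A≡B , ψS
  common-reflects (list {σ} {τ} refl len) ψR                =
    let ψzip , ψS = ++⁻ (zipWith _≐_ σ τ) ψR in zip-solves σ τ len ψzip , ψS

  coreU-reflects : ∀ {e S R} → CoreU e S R → Unifies ψ R → Solves ψ e × Unifies ψ S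
  coreU-reflects (common c)              ψR             = common-reflects c ψR
  coreU-reflects (subs {a} {A} refl _ _) (ψa≡ψA ∷ ψS′) =
    ψa≡ψA , All.map (λ {s} → reflect s) (map⁻ ψS′)
    where
    reflect : ∀ s → Solves ψ (substEq a A s) → Solves ψ s
    reflect (B ≐ C)  ψs = trans (sym (sub-sub-[:=] ψa≡ψA B)) (trans ψs (sub-sub-[:=] ψa≡ψA C))
    reflect (σ ≐ₗ τ) ψs = trans (sym (subL-subL-[:=] ψa≡ψA σ)) (trans ψs (subL-subL-[:=] ψa≡ψA τ))

  coreO-reflects : ∀ {e S R} → CoreO e S R → Unifies ψ R → Solves ψ e × Unifies ψ S
  coreO-reflects (common c)              ψR             = common-reflects c ψR
  coreO-reflects (subs {a} {A} refl _ _) (ψa≡ψA ∷ ψS′) =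
    ψa≡ψA , All.map (λ {s} → reflect s) (map⁻ ψS′)
    where
    reflect : ∀ s → Solves ψ (substOEq a A s) → Solves ψ s
    reflect (B ≐ C)  ψs = trans (sym (sub-substO ψa≡ψA B)) (trans ψs (sub-substO ψa≡ψA C))
    reflect (σ ≐ₗ τ) ψs = ψs

common-preserves-WF : ∀ {e S R} → CoreCommon e S R → WFEq e → All WFEq S → All WFEq R
common-preserves-WF (erase refl)  _                         wfS = wfS
common-preserves-WF (swap refl)   (σA , a)                  wfS = (a , σA) ∷ wfS
common-preserves-WF (arrow refl)  (⇒ₚWF _ σ A , ⇒ₚWF _ τ B) wfS = (σ , τ) ∷ (A , B) ∷ wfS
common-preserves-WF (list refl _) (σ , τ)                   wfS = ++⁺ (zip-WF σ τ) wfS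

coreU-preserves-WF : ∀ {e S R} → CoreU e S R → WFEq e → All WFEq S → All WFEq R
coreU-preserves-WF (common c)          wfe          wfS = common-preserves-WF c wfe wfS
coreU-preserves-WF (subs {a} refl _ _) (wf-a , wf-A) wfS =
  (wf-a , wf-A) ∷ map⁺ (All.map (λ {s} → preserve s) wfS)
  where
  preserve : ∀ s → WFEq s → WFEq (substEq a _ s)
  preserve (B ≐ C)  (B′ , C′) = sub-WF ([:=]-WF a wf-A) B′ , sub-WF ([:=]-WF a wf-A) C′
  preserve (σ ≐ₗ τ) (σ′ , τ′) = subL-WF ([:=]-WF a wf-A) σ′ , subL-WF ([:=]-WF a wf-A) τ′

coreO-preserves-WF : ∀ {e S R} → CoreO e S R → WFEq e → All WFEq S → All WFEq R
coreO-preserves-WF (common c)          wfe          wfS = common-preserves-WF c wfe wfS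
coreO-preserves-WF (subs {a} refl _ _) (wf-a , wf-A) wfS =
  (wf-a , wf-A) ∷ map⁺ (All.map (λ {s} → preserve s) wfS)
  where
  preserve : ∀ s → WFEq s → WFEq (substOEq a _ s)
  preserve (B ≐ C)  (B′ , C′) = substO-WF a wf-A B′ , substO-WF a wf-A C′
  preserve (σ ≐ₗ τ) wfs       = wfs

defines? : ∀ a e → Dec (Σ PType λ B → e ≡ (pv a ≐ B))
defines? a (pv b ≐ B) with a ≟ b
... | yes refl = yes (B , refl)
... | no a≢b   = no λ { (_ , refl) → a≢b refl }
defines? a ((_ ⇒ₚ _) ≐ _) = no λ { (_ , ()) }
defines? a (_ ≐ₗ _)       = no λ { (_ , ()) }

defined? : ∀ a E → (Σ PType λ B → (pv a ≐ B) ∈ E) ⊎ (∀ B → ¬ (pv a ≐ B) ∈ E)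
defined? a E with any? (defines? a) E
... | yes a-defined  = let e , e∈E , B , e≡ = find a-defined in inj₁ (B , subst (_∈ E) e≡ e∈E)
... | no a-undefined = inj₂ (λ B a∈E → a-undefined (lose a∈E (B , refl)))

mgu-cases : ∀ {E ψ} → IsMgu E ψ → ∀ a →
            (Σ PType λ B → (pv a ≐ B) ∈ E × ψ a ≡ B) ⊎ ψ a ≡ pv a
mgu-cases {E} (ψ-defined , ψ-undefined) a with defined? a E
... | inj₁ (B , a∈E) = inj₁ (B , a∈E , ψ-defined a B a∈E)
... | inj₂ a∉E       = inj₂ (ψ-undefined a a∉E)

mgu-unifies : ∀ {E ψ} → Solved E → IsMgu E ψ → Unifies ψ E
mgu-unifies {E} {ψ} (solved , _ , rhs-undefined) mgu = All.tabulate unify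
  where
  unify : ∀ {e} → e ∈ E → Solves ψ e
  unify {e} e∈E with solved e e∈E
  ... | a , B , refl = trans (proj₁ mgu a B e∈E) (sym (sub-fixes B ψ-fixes))
    where
    ψ-fixes : ∀ b → b ∈PT B → ψ b ≡ pv b
    ψ-fixes b b∈B with mgu-cases mgu b
    ... | inj₁ (B′ , b∈E , _) = ⊥-elim (rhs-undefined b B′ a B b∈E e∈E b∈B)
    ... | inj₂ ψb≡b           = ψb≡b

mgu-WF : ∀ {E ψ} → IsMgu E ψ → All WFEq E → ∀ a → WFₚ (ψ a)
mgu-WF mgu wfE a with mgu-cases mgu a
... | inj₁ (B , a∈E , refl) = proj₂ (All.lookup wfE a∈E)
... | inj₂ ψa≡a             = subst WFₚ (sym ψa≡a) (pvWF a)

mutual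
  envT-WF : ∀ t → Strong t → ∀ y → All WFₚ (envT t y)
  envT-WF (rVar Γ _ _) (x , a , _ , _ , Γx , Γy) y with y ≟ x
  ... | yes refl = subst (All WFₚ) (sym Γx) (pvWF a ∷ [])
  ... | no y≢x   = subst (All WFₚ) (sym (Γy y y≢x)) []
  envT-WF (rApp Γ _ _ t u) (_ , St , Su , _ , _ , _ , _ , _ , _ , Γ≡) y =
    subst (All WFₚ) (sym (Γ≡ y)) (++⁺ (envT-WF t St y) (envM-WF u Su y))
  envT-WF (rAbsI Γ x _ _ t) (_ , St , _ , _ , Γx , Γy , _) y with y ≟ x
  ... | yes refl = subst (All WFₚ) (sym Γx) []
  ... | no y≢x   = subst (All WFₚ) (sym (Γy y y≢x)) (envT-WF t St y)
  envT-WF (rAbsK Γ _ _ _ _ t) (_ , _ , St , _ , _ , Γ≡ , _) y =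
    subst (All WFₚ) (sym (Γ≡ y)) (envT-WF t St y)

  envM-WF : ∀ u → StrongM u → ∀ y → All WFₚ (envM u y)
  envM-WF (rMany Γ _ _ ts) (_ , Sts , _ , _ , _ , _ , Γ≡) y =
    subst (All WFₚ) (sym (Γ≡ y)) (envL-WF ts Sts y)

  envL-WF : ∀ ts → StrongL ts → ∀ y → All WFₚ (concat (map (λ t → envT t y) ts))
  envL-WF []       _          y = []
  envL-WF (t ∷ ts) (St , Sts) y = ++⁺ (envT-WF t St y) (envL-WF ts Sts y)

tyM-WF : ∀ u → StrongM u → tyM u ≢ [] × All WFₚ (tyM u)
tyM-WF (rMany _ _ _ ts) (ts≢[] , _ , _ , vars , refl , _) =
  ≢[]-preserved (map tyT) (λ ()) ts≢[] , map⁺ (All.map IsVar-WF vars)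

mutual
  eqs-WF : ∀ t → Strong t → All WFEq (eqs t)
  eqs-WF (rVar _ _ _)          _ = []
  eqs-WF (rApp _ _ _ t u) (c , St , Su , _ , var , refl , _) =
    let μ≢[] , μ = tyM-WF u Su in
    ++⁺ (eqs-WF t St) (++⁺ (eqsM-WF u Su) ((IsVar-WF var , ⇒ₚWF μ≢[] μ (pvWF c)) ∷ []))
  eqs-WF (rAbsI _ x _ _ t) (b , St , _ , tx≢[] , _ , _ , var , refl , _) =
    ++⁺ (eqs-WF t St) ((pvWF b , ⇒ₚWF tx≢[] (envT-WF t St x) (IsVar-WF var)) ∷ [])
  eqs-WF (rAbsK _ _ _ _ _ t) (b , c , St , _ , _ , _ , var , refl , refl , _) =
    ++⁺ (eqs-WF t St) ((pvWF c , ⇒ₚWF (λ ()) (pvWF b ∷ []) (IsVar-WF var)) ∷ [])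

  eqsM-WF : ∀ u → StrongM u → All WFEq (eqsM u)
  eqsM-WF (rMany _ _ _ ts) (_ , Sts , _) = eqsL-WF ts Sts

  eqsL-WF : ∀ ts → StrongL ts → All WFEq (eqsL ts)
  eqsL-WF []       _          = []
  eqsL-WF (t ∷ ts) (St , Sts) = ++⁺ (eqs-WF t St) (eqsL-WF ts Sts)

exp-strong : ∀ {σ n Π Π′} → Strong Π → Exp σ n Π Π′ → Strong Π′
exp-strong _  (expand _ SΠ′) = SΠ′
exp-strong SΠ (keep _)       = SΠ

expChoice-strong : ∀ {σ τ Π Π′} → Strong Π → ExpChoice σ τ Π Π′ → Strong Π′
expChoice-strong SΠ (inj₁ (_ , exp)) = exp-strong SΠ exp
expChoice-strong SΠ (inj₂ (_ , exp)) = exp-strong SΠ exp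

loop-invariant : ∀ {Π E Π′ E′} → Loop Π E Π′ E′ → Strong Π → Star _→o_ (eqs Π) E →
                 Strong Π′ × Star _→o_ (eqs Π′) E′
loop-invariant (stop _)                 SΠ Π↠E = SΠ , Π↠E
loop-invariant (step _ _ choice nf loop) SΠ _   =
  loop-invariant loop (expChoice-strong SΠ choice) (proj₁ nf)

module _ {S T : Set} (f : S → T) where

  envT-mapTree : ∀ t y → envT (mapTree f t) y ≡ map f (envT t y)
  envT-mapTree (rVar _ _ _)          y = refl
  envT-mapTree (rApp _ _ _ _ _)      y = refl
  envT-mapTree (rAbsI _ _ _ _ _)     y = refl
  envT-mapTree (rAbsK _ _ _ _ _ _)   y = refl

  subjT-mapTree : ∀ t → subjT (mapTree f t) ≡ subjT t
  subjT-mapTree (rVar _ _ _)        = refl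
  subjT-mapTree (rApp _ _ _ _ _)    = refl
  subjT-mapTree (rAbsI _ _ _ _ _)   = refl
  subjT-mapTree (rAbsK _ _ _ _ _ _) = refl

  tyT-mapTree : ∀ t → tyT (mapTree f t) ≡ f (tyT t)
  tyT-mapTree (rVar _ _ _)        = refl
  tyT-mapTree (rApp _ _ _ _ _)    = refl
  tyT-mapTree (rAbsI _ _ _ _ _)   = refl
  tyT-mapTree (rAbsK _ _ _ _ _ _) = refl

  envM-mapMTree : ∀ u y → envM (mapMTree f u) y ≡ map f (envM u y)
  envM-mapMTree (rMany _ _ _ _) y = refl

  subjM-mapMTree : ∀ u → subjM (mapMTree f u) ≡ subjM u
  subjM-mapMTree (rMany _ _ _ _) = refl

  tyM-mapMTree : ∀ u → tyM (mapMTree f u) ≡ map f (tyM u)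
  tyM-mapMTree (rMany _ _ _ _) = refl

  map-tyT-mapTrees : ∀ ts → map f (map tyT ts) ≡ map tyT (mapTrees f ts)
  map-tyT-mapTrees []       = refl
  map-tyT-mapTrees (t ∷ ts) = cong₂ _∷_ (sym (tyT-mapTree t)) (map-tyT-mapTrees ts)

  map-envT-mapTrees : ∀ ts y → map f (concat (map (λ t → envT t y) ts))
                               ≡ concat (map (λ t → envT t y) (mapTrees f ts))
  map-envT-mapTrees []       y = refl
  map-envT-mapTrees (t ∷ ts) y =
    trans (map-++ f (envT t y) _) (cong₂ _++_ (sym (envT-mapTree t y)) (map-envT-mapTrees ts y))

  subjT-mapTrees : ∀ {M} ts → All (λ t → subjT t ≡ M) ts → All (λ t → subjT t ≡ M) (mapTrees f ts)
  subjT-mapTrees []       []       = []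
  subjT-mapTrees (t ∷ ts) (p ∷ ps) = trans (subjT-mapTree t) p ∷ subjT-mapTrees ts ps

mL-subL : ∀ ψ σ → mL (subL ψ σ) ≡ map (mψ ψ) σ
mL-subL ψ []      = refl
mL-subL ψ (A ∷ σ) = cong (mψ ψ A ∷_) (mL-subL ψ σ)

module _ {ψ : ℕ → PType} (ψ-WF : ∀ a → WFₚ (ψ a)) where

  private
    f : PType → Ty
    f = mψ ψ

  mutual
    strong-derivS : ∀ t → Strong t → Unifies ψ (eqs t) → DerivS (mapTree f t)
    strong-derivS (rVar Γ _ _) (x , a , refl , refl , Γx , Γy) _ =
      x , refl , mP-WF (ψ-WF a) , ≡⇒≈M (cong (map f) Γx) , λ y y≢x → cong (map f) (Γy y y≢x)
    strong-derivS (rApp Γ _ _ t u) (c , St , Su , refl , _ , refl , _ , _ , _ , Γ≡) ψE =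
      strong-derivS t St (++⁻ˡ (eqs t) ψE)
      , strong-derivSM u Su (++⁻ˡ (eqsM u) ψu∷e)
      , cong₂ _·_ (sym (subjT-mapTree f t)) (sym (subjM-mapMTree f u))
      , ≡⇒≈T tyT≡
      , ≡⇒≈M ∘ env≡
      where
      open ≡-Reasoning

      ψu∷e : Unifies ψ (eqsM u ++ (tyT t ≐ (tyM u ⇒ₚ pv c)) ∷ [])
      ψu∷e = ++⁻ʳ (eqs t) ψE

      tyT≡ : tyT (mapTree f t) ≡ (tyM (mapMTree f u) ⇒ f (pv c))
      tyT≡ = begin
        tyT (mapTree f t)              ≡⟨ tyT-mapTree f t ⟩
        mP (sub ψ (tyT t))             ≡⟨ cong mP (All.head (++⁻ʳ (eqsM u) ψu∷e)) ⟩
        mL (subL ψ (tyM u)) ⇒ f (pv c) ≡⟨ cong (_⇒ f (pv c)) (mL-subL ψ (tyM u)) ⟩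
        map f (tyM u) ⇒ f (pv c)       ≡⟨ cong (_⇒ f (pv c)) (sym (tyM-mapMTree f u)) ⟩
        tyM (mapMTree f u) ⇒ f (pv c)  ∎

      env≡ : ∀ y → map f (Γ y) ≡ envT (mapTree f t) y ++ envM (mapMTree f u) y
      env≡ y = begin
        map f (Γ y)                                   ≡⟨ cong (map f) (Γ≡ y) ⟩
        map f (envT t y ++ envM u y)                  ≡⟨ map-++ f (envT t y) (envM u y) ⟩
        map f (envT t y) ++ map f (envM u y)          ≡⟨ cong₂ _++_ (sym (envT-mapTree f t y))
                                                                    (sym (envM-mapMTree f u y)) ⟩
        envT (mapTree f t) y ++ envM (mapMTree f u) y ∎

    strong-derivS (rAbsI Γ x _ _ t) (b , St , refl , tx≢[] , Γx , Γy , _ , refl , _) ψE =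
      let ψt , ψe = ++⁻ (eqs t) ψE in
      strong-derivS t St ψt
      , cong (ƛ x ⇒_) (sym (subjT-mapTree f t))
      , subst (_≢ []) (sym (envT-mapTree f t x)) (≢[]-preserved (map f) (λ ()) tx≢[])
      , cong (map f) Γx
      , (λ y y≢x → ≡⇒≈M (trans (cong (map f) (Γy y y≢x)) (sym (envT-mapTree f t y))))
      , ≡⇒≈T (trans (cong mP (All.head ψe))
                    (cong₂ _⇒_ (trans (mL-subL ψ (envT t x)) (sym (envT-mapTree f t x)))
                               (sym (tyT-mapTree f t))))
    strong-derivS (rAbsK Γ x _ _ _ t) (b , c , St , refl , tx≡[] , Γ≡ , _ , refl , refl , _) ψE =
      let ψt , ψe = ++⁻ (eqs t) ψE in
      strong-derivS t St ψt
      , cong (ƛ x ⇒_) (sym (subjT-mapTree f t))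
      , trans (envT-mapTree f t x) (cong (map f) tx≡[])
      , (λ y → ≡⇒≈M (trans (cong (map f) (Γ≡ y)) (sym (envT-mapTree f t y))))
      , mP-WF (ψ-WF b)
      , ≡⇒≈T (trans (cong mP (All.head ψe)) (cong ((f (pv b) ∷ []) ⇒_) (sym (tyT-mapTree f t))))

    strong-derivSM : ∀ u → StrongM u → Unifies ψ (eqsM u) → DerivSM (mapMTree f u)
    strong-derivSM (rMany Γ _ _ ts) (ts≢[] , Sts , subjs , _ , refl , _ , Γ≡) ψE =
      ≢[]-preserved (mapTrees f) (λ ()) ts≢[]
      , strong-derivSL ts Sts ψE
      , subjT-mapTrees f ts subjs
      , ≡⇒≈M (map-tyT-mapTrees f ts)
      , λ y → ≡⇒≈M (trans (cong (map f) (Γ≡ y)) (map-envT-mapTrees f ts y))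

    strong-derivSL : ∀ ts → StrongL ts → Unifies ψ (eqsL ts) → DerivSL (mapTrees f ts)
    strong-derivSL []       _          _  = tt
    strong-derivSL (t ∷ ts) (St , Sts) ψE =
      let ψt , ψts = ++⁻ (eqs t) ψE in strong-derivS t St ψt , strong-derivSL ts Sts ψts

theorem4p6 : (M : Term) (Π : Tree PType) (ψ : ℕ → PType) →
    InferStrong M Π ψ → DerivS (mapTree (mψ ψ) Π)
theorem4p6 M Π ψ (run (SΠ₀ , _) nf₀ loop (E↠Eu , _) solved mgu)
  with loop-invariant loop SΠ₀ (proj₁ nf₀)
... | SΠ , EΠ↠E = strong-derivS ψ-WF Π SΠ ψ-unifies-EΠ
  where

  ψ-WF : ∀ a → WFₚ (ψ a)
  ψ-WF = mgu-WF mgu (star-preserves coreU-preserves-WF E↠Eu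
                       (star-preserves coreO-preserves-WF EΠ↠E (eqs-WF Π SΠ)))

  ψ-unifies-EΠ : Unifies ψ (eqs Π)
  ψ-unifies-EΠ = star-reflects coreO-reflects EΠ↠E
                   (star-reflects coreU-reflects E↠Eu (mgu-unifies solved mgu))
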